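{- (i) Let $k\geq 3$ be an integer. There are no integers $n,m,t$ with $2\leq m<n=t+2$ and $F_n^{(k)}+F_m^{(k)}=2^t$ such that either $(n,m)\in[2,k+1]^2$ or $(n,m)\in[k+2,2k+2]^2$. (ii) For every integer $s\geq 1$ and every integer $k\geq 2$ with $k\geq 2^s+s-2$, the quadruple $(n,m,t,k)=(2^s+k,\,2^s+s-1,\,2^s+k-2,\,k)$ satisfies $F_n^{(k)}+F_m^{(k)}=2^t$, with $2\leq m\leq k+1$, $k+2\leq n\leq 2k+2$, and $n=t+2$.
   Context: For an integer $k\geq 2$, the $k$-generalized Fibonacci sequence $(F_n^{(k)})_{n\geq -(k-2)}$ is defined by $F_{ -(k-2)}^{(k)}=\cdots=F_0^{(k)}=0$, $F_1^{(k)}=1$, and $F_{n+k}^{(k)}=F_{n+k-1}^{(k)}+\cdots+F_n^{(k)}$ for all $n\geq -(k-2)$. For integers $a<b$, $[a,b]$ denotes $\{a,a+1,\ldots,b\}$. -}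

module Defs where

open import Data.Nat using (ℕ; zero; suc; _+_)
open import Data.List using (List; []; _∷_; take)
open import Data.Nat.ListAction using (sum)

-- hist k n = [F_n, F_{n-1}, ..., F_0] of the k-generalized Fibonacci sequence
-- (the terms F_{-(k-2)},...,F_{-1} are 0 and so contribute nothing to sums).
hist : ℕ → ℕ → List ℕ
hist k zero = 0 ∷ []
hist k (suc zero) = 1 ∷ 0 ∷ []
hist k (suc (suc n)) = sum (take k (hist k (suc n))) ∷ hist k (suc n)

F : ℕ → ℕ → ℕ
F k n with hist k n
... | [] = 0
... | x ∷ _ = x

module Submission where

-- The proof rests on two
-- closed forms, both consequences of the "doubling" recurrence
--   F_{p+3} + F_{p+2-k} = 2 F_{p+2}   (terms of negative index being 0),
-- which follows by comparing the windows of k terms defining F_{p+3} and F_{p+2}: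
--   (A) F_{p+2} = 2^p                              for 0 ≤ p ≤ k - 1,
--   (B) 2 F_{k+2+q} + (q+2) 2^q = 2^{k+1+q}         for 0 ≤ q ≤ k.
-- Part (i), lower block: by (A) the equation reads 2^p + 2^q = 2^p, impossible.
-- Part (i), upper block: writing n = k+2+j+d, m = k+2+j, formula (B) turns
-- F_n + F_m = 2^{n-2} into the "key equation"  (j+d+2) 2^d + (j+2) = 2^{k+1}.
-- Since 2^d divides j+2, its left side is at most (k+2)^2 + (k+2) < 2^{k+1}
-- when k ≥ 5; the cases k = 3, 4 are settled by a finite decision procedure.
-- Part (ii): with 2^s = q + 2, the sum F_{k+2+q} + F_{q+s+1} equals 2^{k+q}
-- by (A) and (B), because (q+2) 2^q = 2^{s+q} = 2 F_{q+s+1}.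

open import Defs
open import Data.Nat using (ℕ; zero; suc; _+_; _*_; _∸_; _^_; _≤_; _<_; _≥_; z≤n; s≤s; _≟_)
open import Data.Nat.Properties
open import Data.Nat.Divisibility using (_∣_; ∣m+n∣m⇒∣n; ∣⇒≤; m∣m*n; n∣m*n)
open import Data.Nat.Solver using (module +-*-Solver)
open import Data.List using (List; []; _∷_; take)
open import Data.Nat.ListAction using (sum)
open import Data.Product using (_×_; _,_; ∃)
open import Data.Sum using (_⊎_; [_,_])
open import Data.Unit using (tt)
open import Relation.Nullary using (¬_; Dec)
open import Relation.Nullary.Decidable using (toWitness; ¬?)
open import Relation.Binary.PropositionalEquality
  using (_≡_; _≢_; refl; sym; trans; cong; cong₂; subst; module ≡-Reasoning)
open +-*-Solver

-- nth i xs is the i-th entry of xs, and 0 past its end; on hist k n it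
-- therefore reads off F_{n-i}, with the convention F_{<0} = 0.
nth : ℕ → List ℕ → ℕ
nth _       []       = 0
nth zero    (x ∷ _)  = x
nth (suc i) (_ ∷ xs) = nth i xs

sum-take-suc : ∀ i (xs : List ℕ) → sum (take (suc i) xs) ≡ sum (take i xs) + nth i xs
sum-take-suc zero    []       = refl
sum-take-suc zero    (x ∷ xs) = +-identityʳ x
sum-take-suc (suc i) []       = refl
sum-take-suc (suc i) (x ∷ xs) = trans (cong (x +_) (sum-take-suc i xs)) (sym (+-assoc x _ _))

hist-suc : ∀ k n → hist k (suc n) ≡ F k (suc n) ∷ hist k n
hist-suc k zero    = refl
hist-suc k (suc n) = refl

nth-hist-head : ∀ k n → nth 0 (hist k n) ≡ F k n
nth-hist-head k zero          = refl
nth-hist-head k (suc zero)    = refl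
nth-hist-head k (suc (suc n)) = refl

nth-hist : ∀ k i j → nth i (hist k (i + j)) ≡ F k j
nth-hist k zero    j = nth-hist-head k j
nth-hist k (suc i) j rewrite hist-suc k (i + j) = nth-hist k i j

nth-hist-past : ∀ k n j → nth (n + j) (hist k n) ≡ 0
nth-hist-past k zero    zero    = refl
nth-hist-past k zero    (suc j) = refl
nth-hist-past k (suc n) j rewrite hist-suc k n = nth-hist-past k n j

-- The doubling recurrence F_{p+3} + F_{p+1-k'} = 2 F_{p+2} for order k = 1 + k':
-- the window defining F_{p+3} is the one defining F_{p+2}, shifted by F_{p+2}.
doubling : ∀ k' p → F (suc k') (3 + p) + nth k' (hist (suc k') (1 + p)) ≡ 2 * F (suc k') (2 + p)
doubling k' p = begin
    F k (3 + p) + nth k' window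
  ≡⟨⟩
    (F k (2 + p) + sum (take k' window)) + nth k' window
  ≡⟨ +-assoc (F k (2 + p)) _ _ ⟩
    F k (2 + p) + (sum (take k' window) + nth k' window)
  ≡⟨ cong (F k (2 + p) +_) (sym (sum-take-suc k' window)) ⟩
    F k (2 + p) + F k (2 + p)
  ≡⟨ cong (F k (2 + p) +_) (sym (+-identityʳ _)) ⟩
    2 * F k (2 + p) ∎
  where
  open ≡-Reasoning
  k = suc k'
  window = hist k (1 + p)

F-two : ∀ k' → F (suc k') 2 ≡ 1
F-two zero           = refl
F-two (suc zero)     = refl
F-two (suc (suc k')) = refl

-- Closed form (A): F_{p+2} = 2^p while p + 2 ≤ k + 1, since then the window of
-- F_{p+3} still reaches back to index ≤ 0 and doubling drops nothing.
F-initial : ∀ k' p → p ≤ k' → F (suc k') (2 + p) ≡ 2 ^ p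
F-initial k' zero    _     = F-two k'
F-initial k' (suc p) p<k' = begin
    F k (3 + p)
  ≡⟨ sym (+-identityʳ _) ⟩
    F k (3 + p) + 0
  ≡⟨ cong (F k (3 + p) +_) (sym dropped-term) ⟩
    F k (3 + p) + nth k' (hist k (1 + p))
  ≡⟨ doubling k' p ⟩
    2 * F k (2 + p)
  ≡⟨ cong (2 *_) (F-initial k' p (<⇒≤ p<k')) ⟩
    2 * 2 ^ p ∎
  where
  open ≡-Reasoning
  k = suc k'
  dropped-term : nth k' (hist k (1 + p)) ≡ 0
  dropped-term with m≤n⇒∃[o]m+o≡n p<k'
  ... | j , refl = nth-hist-past k (1 + p) j

-- Closed form (B): 2 F_{k+2+q} + (q+2) 2^q = 2^{k+1+q} for q ≤ k.  The base case
-- is doubling with dropped term F_1 = 1; each step drops F_{q+2} = 2^q by (A).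
F-upper : ∀ k' q → q ≤ suc k' → 2 * F (suc k') (2 + suc k' + q) + (2 + q) * 2 ^ q ≡ 2 ^ (suc (suc k') + q)
F-upper k' zero _ rewrite +-identityʳ k' = begin
    2 * F k (3 + k') + 2 * 1
  ≡⟨ sym (*-distribˡ-+ 2 (F k (3 + k')) 1) ⟩
    2 * (F k (3 + k') + 1)
  ≡⟨ cong (λ x → 2 * (F k (3 + k') + x)) (sym dropped-term) ⟩
    2 * (F k (3 + k') + nth k' (hist k (1 + k')))
  ≡⟨ cong (2 *_) (doubling k' k') ⟩
    2 * (2 * F k (2 + k'))
  ≡⟨ cong (λ x → 2 * (2 * x)) (F-initial k' k' ≤-refl) ⟩
    2 ^ (2 + k') ∎
  where
  open ≡-Reasoning
  k = suc k'
  dropped-term : nth k' (hist k (1 + k')) ≡ 1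
  dropped-term = subst (λ n → nth k' (hist k n) ≡ 1) (+-comm k' 1) (nth-hist k k' 1)
F-upper k' (suc q) q<k rewrite +-suc k' q = begin
    2 * A + (3 + q) * (2 * B)
  ≡⟨ solve 4 (λ a b c q → con 2 :* a :+ (con 3 :+ q) :* (con 2 :* b)
                := con 2 :* (a :+ b) :+ con 2 :* ((con 2 :+ q) :* b)) refl A B C q ⟩
    2 * (A + B) + 2 * ((2 + q) * B)
  ≡⟨ cong (λ x → 2 * x + 2 * ((2 + q) * B)) step ⟩
    2 * (2 * C) + 2 * ((2 + q) * B)
  ≡⟨ sym (*-distribˡ-+ 2 (2 * C) _) ⟩
    2 * (2 * C + (2 + q) * B)
  ≡⟨ cong (2 *_) (F-upper k' q (<⇒≤ q<k)) ⟩
    2 ^ (3 + (k' + q)) ∎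
  where
  open ≡-Reasoning
  k = suc k'
  A = F k (4 + (k' + q))
  B = 2 ^ q
  C = F k (3 + (k' + q))
  dropped-term : nth k' (hist k (2 + (k' + q))) ≡ B
  dropped-term = begin
      nth k' (hist k (2 + (k' + q)))
    ≡⟨ cong (λ n → nth k' (hist k n)) (sym (trans (+-suc k' (suc q)) (cong suc (+-suc k' q)))) ⟩
      nth k' (hist k (k' + (2 + q)))
    ≡⟨ nth-hist k k' (2 + q) ⟩
      F k (2 + q)
    ≡⟨ F-initial k' q (≤-pred q<k) ⟩
      B ∎
  step : A + B ≡ 2 * C
  step = subst (λ x → A + x ≡ 2 * C) dropped-term (doubling k' (suc (k' + q)))

-- The key equation (j + d + 2) 2^d + (j + 2) = 2^{k+1}, to which an upper-block
-- solution of F_n + F_m = 2^{n-2} reduces.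
KeyEquation : ℕ → ℕ → ℕ → Set
KeyEquation k j d = (2 + (j + d)) * 2 ^ d + (2 + j) ≡ 2 ^ suc k

key-equation-bounded? : ∀ k → Dec (∀ {j} → j < suc k → ∀ {d} → d < suc k → ¬ KeyEquation k j d)
key-equation-bounded? k = allUpTo? (λ j → allUpTo? (λ d → ¬? (_ ≟ _)) (suc k)) (suc k)

-- (k + 2)^2 + (k + 2) < 2^{k+1} for k = 5 + b: true at k = 5 (56 < 64), and
-- the left side less than doubles with each increment of k.
quadratic<power : ∀ b → (7 + b) * (7 + b) + (7 + b) < 2 ^ (6 + b)
quadratic<power zero    = m≤m+n 57 7
quadratic<power (suc b) = ≤-<-trans less-than-double (*-monoʳ-< 2 (quadratic<power b))
  where
  less-than-double : (8 + b) * (8 + b) + (8 + b) ≤ 2 * ((7 + b) * (7 + b) + (7 + b))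
  less-than-double = subst ((8 + b) * (8 + b) + (8 + b) ≤_)
    (solve 1 (λ b → (con 8 :+ b) :* (con 8 :+ b) :+ (con 8 :+ b) :+ (con 40 :+ con 13 :* b :+ b :* b)
               := con 2 :* ((con 7 :+ b) :* (con 7 :+ b) :+ (con 7 :+ b))) refl b)
    (m≤m+n _ _)

^-divides : ∀ a d e → a ^ d ∣ a ^ (d + e)
^-divides a d e = subst (a ^ d ∣_) (sym (^-distribˡ-+-* a d e)) (m∣m*n (a ^ e))

-- For k ≥ 5: 2^d divides 2^{k+1} and (j+d+2) 2^d, hence j + 2; so the left
-- side of the key equation is at most (k+2)^2 + (k+2) < 2^{k+1}.
key-equation-large : ∀ b j d → j + d ≤ 5 + b → ¬ KeyEquation (5 + b) j d
key-equation-large b j d j+d≤k key = <-irrefl key (≤-<-trans left-bound (quadratic<power b))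
  where
  d≤k+1 : d ≤ 6 + b
  d≤k+1 = ≤-trans (m+n≤o⇒n≤o j j+d≤k) (n≤1+n _)
  2^d∣2^k+1 : 2 ^ d ∣ 2 ^ (6 + b)
  2^d∣2^k+1 = subst (λ e → 2 ^ d ∣ 2 ^ e) (m+[n∸m]≡n d≤k+1) (^-divides 2 d (6 + b ∸ d))
  2^d∣j+2 : 2 ^ d ∣ 2 + j
  2^d∣j+2 = ∣m+n∣m⇒∣n (subst (2 ^ d ∣_) (sym key) 2^d∣2^k+1) (n∣m*n (2 + (j + d)))
  j+2≤k+2 : 2 + j ≤ 7 + b
  j+2≤k+2 = s≤s (s≤s (m+n≤o⇒m≤o j j+d≤k))
  left-bound : (2 + (j + d)) * 2 ^ d + (2 + j) ≤ (7 + b) * (7 + b) + (7 + b)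
  left-bound = +-mono-≤ (*-mono-≤ (s≤s (s≤s j+d≤k)) (≤-trans (∣⇒≤ 2^d∣j+2) j+2≤k+2)) j+2≤k+2

key-equation-impossible : ∀ {k} j d → 3 ≤ k → j + d ≤ k → ¬ KeyEquation k j d
key-equation-impossible {1} _ _ (s≤s ())
key-equation-impossible {2} _ _ (s≤s (s≤s ()))
key-equation-impossible {3} j d _ j+d≤k =
  toWitness {a? = key-equation-bounded? 3} tt (s≤s (m+n≤o⇒m≤o j j+d≤k)) (s≤s (m+n≤o⇒n≤o j j+d≤k))
key-equation-impossible {4} j d _ j+d≤k =
  toWitness {a? = key-equation-bounded? 4} tt (s≤s (m+n≤o⇒m≤o j j+d≤k)) (s≤s (m+n≤o⇒n≤o j j+d≤k))
key-equation-impossible {suc (suc (suc (suc (suc b))))} j d _ j+d≤k = key-equation-large b j d j+d≤k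

interval : ∀ {a b n} → a ≤ n × n ≤ a + b → ∃ λ q → a + q ≡ n × q ≤ b
interval {a} {b} (a≤n , n≤a+b) with m≤n⇒∃[o]m+o≡n a≤n
... | q , refl = q , refl , +-cancelˡ-≤ a q b n≤a+b

drop-two : ∀ {x t} → 2 + x ≡ t + 2 → x ≡ t
drop-two {x} {t} eq = suc-injective (suc-injective (trans eq (+-comm t 2)))

upper-block-end : ∀ k → 2 * k + 2 ≡ 2 + k + k
upper-block-end = solve 1 (λ k → con 2 :* k :+ con 2 := con 2 :+ k :+ k) refl

lower-block-form : ∀ {k' x} → x ≤ suc k' + 1 → x ≤ 2 + k'
lower-block-form {k'} x≤ = ≤-trans x≤ (≤-reflexive (+-comm (suc k') 1))

upper-block-form : ∀ {k x} → k + 2 ≤ x × x ≤ 2 * k + 2 → 2 + k ≤ x × x ≤ 2 + k + k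
upper-block-form {k} (lo , hi) =
  ≤-trans (≤-reflexive (+-comm 2 k)) lo , ≤-trans hi (≤-reflexive (upper-block-end k))

-- Lower block: by (A), F_{p+2} + F_{q+2} = 2^p would say 2^p + 2^q = 2^p.
lower-block-sum : ∀ k' p q → p ≤ k' → q ≤ k' → F (suc k') (2 + p) + F (suc k') (2 + q) ≢ 2 ^ p
lower-block-sum k' p q p≤k' q≤k' sum-eq = <-irrefl (sym powers-eq) (m<m+n (2 ^ p) (m^n>0 2 q))
  where
  powers-eq : 2 ^ p + 2 ^ q ≡ 2 ^ p
  powers-eq = trans (sym (cong₂ _+_ (F-initial k' p p≤k') (F-initial k' q q≤k'))) sum-eq

-- Upper block: F_n + F_m = 2^{n-2} with n = k+2+j+d and m = k+2+j forces the
-- key equation.  By (B) twice, 2 F_m = (j+d+2) 2^{j+d} and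
-- (j+d+2) 2^{j+d} + (j+2) 2^j = 2^{k+1+j}; now cancel 2^j.
upper-block-key-equation : ∀ k' j d → j + d ≤ suc k' →
  F (suc k') (2 + suc k' + (j + d)) + F (suc k') (2 + suc k' + j) ≡ 2 ^ (suc k' + (j + d)) →
  KeyEquation (suc k') j d
upper-block-key-equation k' j d i≤k sum-eq = *-cancelˡ-≡ _ _ (2 ^ j) {{m^n≢0 2 j}} (begin
    2 ^ j * ((2 + i) * 2 ^ d + (2 + j))
  ≡⟨ solve 4 (λ p a x b → p :* (a :* x :+ b) := a :* (p :* x) :+ b :* p) refl (2 ^ j) (2 + i) (2 ^ d) (2 + j) ⟩
    (2 + i) * (2 ^ j * 2 ^ d) + (2 + j) * 2 ^ j
  ≡⟨ cong (λ x → (2 + i) * x + (2 + j) * 2 ^ j) (sym (^-distribˡ-+-* 2 j d)) ⟩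
    (2 + i) * 2 ^ i + (2 + j) * 2 ^ j
  ≡⟨ cong (_+ (2 + j) * 2 ^ j) (sym twice-Fm) ⟩
    2 * Fm + (2 + j) * 2 ^ j
  ≡⟨ F-upper k' j (m+n≤o⇒m≤o j i≤k) ⟩
    2 ^ (suc k + j)
  ≡⟨ cong (2 ^_) (+-comm (suc k) j) ⟩
    2 ^ (j + suc k)
  ≡⟨ ^-distribˡ-+-* 2 j (suc k) ⟩
    2 ^ j * 2 ^ suc k ∎)
  where
  open ≡-Reasoning
  k = suc k'
  i = j + d
  Fn = F k (2 + k + i)
  Fm = F k (2 + k + j)
  twice-Fm : 2 * Fm ≡ (2 + i) * 2 ^ i
  twice-Fm = +-cancelˡ-≡ (2 * Fn) _ _ (begin
      2 * Fn + 2 * Fm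
    ≡⟨ sym (*-distribˡ-+ 2 Fn Fm) ⟩
      2 * (Fn + Fm)
    ≡⟨ cong (2 *_) sum-eq ⟩
      2 ^ (suc k + i)
    ≡⟨ sym (F-upper k' i i≤k) ⟩
      2 * Fn + (2 + i) * 2 ^ i ∎)

no-lower-solution : ∀ {k n m t} → 1 ≤ k → n ≡ t + 2 →
  (2 ≤ n × n ≤ k + 1) → (2 ≤ m × m ≤ k + 1) → F k n + F k m ≢ 2 ^ t
no-lower-solution {suc k'} _ n≡t+2 (2≤n , n≤k+1) (2≤m , m≤k+1)
  with interval (2≤n , lower-block-form {k'} n≤k+1) | interval (2≤m , lower-block-form {k'} m≤k+1)
... | p , refl , p≤k' | q , refl , q≤k' with drop-two n≡t+2
... | refl = lower-block-sum k' p q p≤k' q≤k'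

no-upper-solution : ∀ {k n m t} → 3 ≤ k → m < n → n ≡ t + 2 →
  (k + 2 ≤ n × n ≤ 2 * k + 2) → (k + 2 ≤ m × m ≤ 2 * k + 2) → F k n + F k m ≢ 2 ^ t
no-upper-solution {suc k'} 3≤k m<n n≡t+2 n-in m-in
  with interval (upper-block-form {suc k'} n-in) | interval (upper-block-form {suc k'} m-in)
... | i , refl , i≤k | j , refl , _
  with m≤n⇒∃[o]m+o≡n (<⇒≤ (+-cancelˡ-< (2 + suc k') j i m<n)) | drop-two n≡t+2
... | d , refl | refl = λ sum-eq →
  key-equation-impossible j d 3≤k i≤k (upper-block-key-equation k' j d i≤k sum-eq)

MixedSolution : ℕ → ℕ → ℕ → ℕ → Set
MixedSolution k n m t =
  (F k n + F k m ≡ 2 ^ t) × (2 ≤ m × m ≤ k + 1) × (k + 2 ≤ n × n ≤ 2 * k + 2) × (n ≡ t + 2)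

-- Part (ii) with 2^s written as 2 + q: since (q + 2) 2^q = 2^{s+q} = 2 F_{q+s+1}
-- by (A), formula (B) gives 2 (F_{k+2+q} + F_{q+s+1}) = 2^{k+1+q}.
mixed-solution : ∀ k' s' q → 2 + q ≡ 2 ^ suc s' → q + s' ≤ k' →
  MixedSolution (suc k') (2 + q + suc k') (2 + q + suc s' ∸ 1) (2 + q + suc k' ∸ 2)
mixed-solution k' s' q 2+q≡2^s q+s'≤k' =
  sum-eq , (2≤m , m≤k+1) , (k+2≤n , n≤2k+2) , +-comm 2 (q + k)
  where
  open ≡-Reasoning
  k = suc k'
  q≤k : q ≤ k
  q≤k = ≤-trans (m≤m+n q s') (m≤n⇒m≤1+n q+s'≤k')
  Fn = F k (2 + q + k)
  Fm = F k (suc (q + suc s'))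
  twice-Fm : 2 * Fm ≡ (2 + q) * 2 ^ q
  twice-Fm = begin
      2 * Fm
    ≡⟨ cong (λ x → 2 * F k (suc x)) (+-suc q s') ⟩
      2 * F k (2 + (q + s'))
    ≡⟨ cong (2 *_) (F-initial k' (q + s') q+s'≤k') ⟩
      2 * 2 ^ (q + s')
    ≡⟨ cong (λ x → 2 * 2 ^ x) (+-comm q s') ⟩
      2 ^ (suc s' + q)
    ≡⟨ ^-distribˡ-+-* 2 (suc s') q ⟩
      2 ^ suc s' * 2 ^ q
    ≡⟨ cong (_* 2 ^ q) (sym 2+q≡2^s) ⟩
      (2 + q) * 2 ^ q ∎
  sum-eq : Fn + Fm ≡ 2 ^ (q + k)
  sum-eq = *-cancelˡ-≡ _ _ 2 (begin
      2 * (Fn + Fm)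
    ≡⟨ *-distribˡ-+ 2 Fn Fm ⟩
      2 * Fn + 2 * Fm
    ≡⟨ cong₂ (λ x y → 2 * F k (2 + x) + y) (+-comm q k) twice-Fm ⟩
      2 * F k (2 + k + q) + (2 + q) * 2 ^ q
    ≡⟨ F-upper k' q q≤k ⟩
      2 ^ (suc k + q)
    ≡⟨ cong (λ x → 2 * 2 ^ x) (+-comm k q) ⟩
      2 * 2 ^ (q + k) ∎)
  2≤m : 2 ≤ suc (q + suc s')
  2≤m = s≤s (≤-trans (s≤s z≤n) (m≤n+m (suc s') q))
  m≤k+1 : suc (q + suc s') ≤ k + 1
  m≤k+1 = ≤-trans (s≤s (≤-reflexive (+-suc q s'))) (≤-trans (s≤s (s≤s q+s'≤k')) (≤-reflexive (+-comm 1 k)))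
  k+2≤n : k + 2 ≤ 2 + q + k
  k+2≤n = ≤-trans (≤-reflexive (+-comm k 2)) (+-monoˡ-≤ k (m≤m+n 2 q))
  n≤2k+2 : 2 + q + k ≤ 2 * k + 2
  n≤2k+2 = ≤-trans (+-monoˡ-≤ k (+-monoʳ-≤ 2 q≤k)) (≤-reflexive (sym (upper-block-end k)))

-- Part (ii): write 2^s = 2 + q; the bound k ≥ 2^s + s - 2 becomes q + s ≤ k.
solution-family : ∀ s k → s ≥ 1 → k ≥ 2 ^ s + s ∸ 2 →
  MixedSolution k (2 ^ s + k) (2 ^ s + s ∸ 1) (2 ^ s + k ∸ 2)
solution-family (suc s') k _ k≥ with m≤n⇒∃[o]m+o≡n (*-monoʳ-≤ 2 (m^n>0 2 s'))
... | q , 2+q≡2^s with subst (_≤ k) (+-suc q s') (subst (λ P → P + suc s' ∸ 2 ≤ k) (sym 2+q≡2^s) k≥)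
... | s≤s q+s'≤k' = subst (λ P → MixedSolution k (P + k) (P + suc s' ∸ 1) (P + k ∸ 2)) 2+q≡2^s
  (mixed-solution _ s' q 2+q≡2^s q+s'≤k')

theorem2 :
  ((k : ℕ) → k ≥ 3 → (n m t : ℕ) → 2 ≤ m → m < n → n ≡ t + 2 →
    F k n + F k m ≡ 2 ^ t →
    ¬ (((2 ≤ n × n ≤ k + 1) × (2 ≤ m × m ≤ k + 1))
       ⊎ ((k + 2 ≤ n × n ≤ 2 * k + 2) × (k + 2 ≤ m × m ≤ 2 * k + 2))))
  ×
  ((s k : ℕ) → s ≥ 1 → k ≥ 2 → k ≥ 2 ^ s + s ∸ 2 →
    let n = 2 ^ s + k
        m = 2 ^ s + s ∸ 1
        t = 2 ^ s + k ∸ 2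
    in (F k n + F k m ≡ 2 ^ t)
       × (2 ≤ m × m ≤ k + 1)
       × (k + 2 ≤ n × n ≤ 2 * k + 2)
       × (n ≡ t + 2))
theorem2 =
  (λ k 3≤k n m t _ m<n n≡t+2 sum-eq →
    [ (λ (n-in , m-in) → no-lower-solution (≤-trans (s≤s z≤n) 3≤k) n≡t+2 n-in m-in sum-eq)
    , (λ (n-in , m-in) → no-upper-solution 3≤k m<n n≡t+2 n-in m-in sum-eq) ])
  , (λ s k s≥1 _ → solution-family s k s≥1)
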